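{- If $n\geq 9$ and $n\neq 11$, then $PRC(C_n)=6$.
   Context: All graphs are simple, finite and undirected. A set $S\subseteq V(G)$ is a dominating set if every vertex not in $S$ has a neighbor in $S$; $S$ is a perfect dominating set if every vertex in $V(G)\setminus S$ has exactly one neighbor in $S$. A perfect coalition in $G$ consists of two disjoint sets $V_1,V_2$ of vertices such that (i) neither $V_1$ nor $V_2$ is a dominating set of $G$; (ii) each vertex in $V(G)\setminus V_1$ has at most one neighbor in $V_1$, and each vertex in $V(G)\setminus V_2$ has at most one neighbor in $V_2$; (iii) $V_1\cup V_2$ is a perfect dominating set of $G$. A perfect coalition partition ($prc$-partition) of $G$ is a vertex partition $\pi=\{V_1,\dots,V_k\}$ such that each $V_i$ either is a singleton dominating set or forms a perfect coalition with some $V_j\in\pi$. $PRC(G)$ is the maximum cardinality of a $prc$-partition of $G$, with $PRC(G)=0$ if $G$ has no $prc$-partition. $C_n$ denotes the cycle on $n$ vertices. -}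

module Defs where

open import Data.Nat using (ℕ; zero; suc; _≤_)
open import Data.Fin using (Fin; toℕ)
open import Data.Product using (Σ; ∃; _×_; _,_)
open import Data.Sum using (_⊎_)
open import Relation.Nullary using (¬_)
open import Relation.Binary.PropositionalEquality using (_≡_)

VSet : ℕ → Set₁
VSet n = Fin n → Set

_∪_ : ∀ {n} → VSet n → VSet n → VSet n
(A ∪ B) v = A v ⊎ B v

Disjoint : ∀ {n} → VSet n → VSet n → Set
Disjoint A B = ∀ v → A v → B v → ⊥'
  where open import Data.Empty renaming (⊥ to ⊥')

module _ {n : ℕ} (Adj : Fin n → Fin n → Set) where

  Dominating : VSet n → Set
  Dominating S = ∀ v → ¬ S v → ∃ λ u → S u × Adj v u

  AtMostOneNbr : VSet n → Fin n → Set
  AtMostOneNbr S v = ∀ u w → S u → S w → Adj v u → Adj v w → u ≡ w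

  ExactlyOneNbr : VSet n → Fin n → Set
  ExactlyOneNbr S v = (∃ λ u → S u × Adj v u) × AtMostOneNbr S v

  PerfectDominating : VSet n → Set
  PerfectDominating S = ∀ v → ¬ S v → ExactlyOneNbr S v

  PerfectCoalition : VSet n → VSet n → Set
  PerfectCoalition V₁ V₂ =
    Disjoint V₁ V₂ ×
    ¬ Dominating V₁ × ¬ Dominating V₂ ×
    (∀ v → ¬ V₁ v → AtMostOneNbr V₁ v) ×
    (∀ v → ¬ V₂ v → AtMostOneNbr V₂ v) ×
    PerfectDominating (V₁ ∪ V₂)

  IsSingleton : VSet n → Set
  IsSingleton S = ∃ λ u → ∀ v → (S v → v ≡ u) × (v ≡ u → S v)

  record Partition (k : ℕ) : Set where
    field
      cls  : Fin n → Fin k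
      surj : ∀ i → ∃ λ v → cls v ≡ i

    Class : Fin k → VSet n
    Class i v = cls v ≡ i

  open Partition public

  IsPrcPartition : ∀ {k} → Partition k → Set
  IsPrcPartition {k} π = ∀ i →
      (IsSingleton (Class π i) × Dominating (Class π i))
    ⊎ (∃ λ j → PerfectCoalition (Class π i) (Class π j))

  HasPrcPartition : ℕ → Set
  HasPrcPartition k = Σ (Partition k) IsPrcPartition

  -- PRC(G) = m  (with PRC(G) = 0 when no prc-partition exists)
  PRC≡ : ℕ → Set
  PRC≡ m = (m ≡ 0 × (∀ k → ¬ HasPrcPartition k))
         ⊎ (HasPrcPartition m × (∀ k → HasPrcPartition k → k ≤ m))

CycleAdj : (n : ℕ) → Fin n → Fin n → Set
CycleAdj n i j =
    (suc (toℕ i) ≡ toℕ j) ⊎ (suc (toℕ j) ≡ toℕ i)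
  ⊎ (suc (toℕ i) ≡ n × toℕ j ≡ 0) ⊎ (suc (toℕ j) ≡ n × toℕ i ≡ 0)

module Submission where

-- For n ≥ 4 no class of a prc-partition of C_n is a dominating singleton, so every
-- class X has a partner p X forming a perfect coalition with it. A non-dominating class X has a gap
-- c, c+1, c+2 ∉ X, c+3 ∈ X, and every Y with X ∪ Y perfectly dominating contains c or c+2; hence in
-- the graph x ~ p x on the classes every class has at most two neighbours. Moreover the classes of
-- v-1, v, v+1 meet every edge {X , p X}. These two properties allow at most six classes: with such a
-- cover T, every class outside T has its image in T, and a cover at one outside class has only two
-- further points to meet the edges of three other outside classes. This fails unless they form two
-- pairs with common images, and then a seventh class would need its image in both pairs.
--
-- A labelling of C_n together with a partner map is a prc-partition as soon as every
-- window of three consecutive labels passes a local test, and every label occurs and is avoided by a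
-- window. Words all of whose windows pass can be pumped by a loop of length 3, which gives
-- n = 9 + 3j, 10 + 3j and 14 + 3j.

open import Defs
open import Data.Empty using (⊥; ⊥-elim)
open import Data.Fin using (Fin; zero; suc; toℕ; fromℕ; fromℕ<; inject₁; _≟_; #_)
open import Data.Fin.Properties
  using (toℕ-injective; toℕ-fromℕ; toℕ-fromℕ<; toℕ-inject₁; toℕ<n; toℕ≤pred[n]; ¬∀⟶∃¬; any?; all?; pigeonhole)
import Data.Fin.Properties as Fin
open import Data.List using (List; []; _∷_; _++_; length; lookup; concat; replicate)
open import Data.List.Properties using (length-++; length-++-≤ˡ; ++-assoc)
open import Data.List.Membership.Propositional using (_∈_; _∉_)
open import Data.List.Membership.Propositional.Properties using (∈-++⁺ˡ; ∈-++⁺ʳ)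
open import Data.List.Relation.Unary.Any using (here; there; index)
open import Data.List.Relation.Unary.Any.Properties using (lookup-index)
open import Data.Nat as ℕ using (ℕ; _+_; _*_; _∸_; _≤_; _<_; _≤?_; z≤n; s≤s)
open import Data.Nat.GeneralisedArithmetic using (iterate)
open import Data.Nat.Properties
  using (suc-injective; m≤m+n; +-identityʳ; +-suc; n≤1+n; m≤n⇒m≤1+n; ≤-antisym; ≤-pred; ≮⇒≥; ≰⇒>; <⇒≢; <⇒≤; ≤-refl; ≤-trans; +-comm; m+[n∸m]≡n; m≤n⇒∃[o]m+o≡n)
open import Data.Product using (∃; ∃₂; _×_; _,_; proj₁; proj₂)
open import Data.Product.Properties using (≡-dec)
open import Data.Sum using (_⊎_; inj₁; inj₂; [_,_]′; swap)
open import Function using (_∘_; id)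
open import Relation.Nullary using (¬_; Dec; yes; no; contradiction)
open import Relation.Nullary.Decidable using (True; toWitness; from-yes; map′; _×-dec_; _⊎-dec_; _→-dec_; ¬?)
open import Relation.Unary using (Decidable)
open import Relation.Binary.Definitions using (DecidableEquality)
open import Relation.Binary.PropositionalEquality
  using (_≡_; _≢_; refl; sym; trans; cong; subst; subst₂; module ≡-Reasoning)
open ≡-Reasoning

iterate-suc : ∀ {A : Set} (f : A → A) x n → iterate f x (ℕ.suc n) ≡ f (iterate f x n)
iterate-suc f x ℕ.zero    = refl
iterate-suc f x (ℕ.suc n) = iterate-suc f (f x) n

iterate-+ : ∀ {A : Set} (f : A → A) x m n → iterate f x (m + n) ≡ iterate f (iterate f x m) n
iterate-+ f x ℕ.zero    n = refl
iterate-+ f x (ℕ.suc m) n = iterate-+ f (f x) m n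

∪-comm-perfectDominating : ∀ {n} {Adj : Fin n → Fin n → Set} {A B : VSet n} →
  PerfectDominating Adj (A ∪ B) → PerfectDominating Adj (B ∪ A)
∪-comm-perfectDominating pd v v∉ with pd v (v∉ ∘ swap)
... | (u , u∈ , v~u) , unique = (u , swap u∈ , v~u) , λ u w u∈ w∈ → unique u w (swap u∈) (swap w∈)

∃-∉ : ∀ {k} (xs : List (Fin k)) → length xs < k → ∃ (_∉ xs)
∃-∉ {k} xs |xs|<k = ¬∀⟶∃¬ k (_∈ xs) (_∈? xs) not-all
  where
  open import Data.List.Membership.DecPropositional (_≟_ {k}) using (_∈?_)
  not-all : ¬ (∀ x → x ∈ xs)
  not-all every with pigeonhole |xs|<k (index ∘ every)
  ... | i , j , i<j , same = Fin.<⇒≢ i<j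
    (trans (lookup-index (every i)) (trans (cong (lookup xs) same) (sym (lookup-index (every j)))))

module _ {n} {E₁ E₂ E₃ : VSet n} (E₁∩E₂ : Disjoint E₁ E₂) (E₁∩E₃ : Disjoint E₁ E₃) where

  hitting-pair : ∀ {a c} → E₁ a ⊎ E₁ c → E₂ a ⊎ E₂ c → E₃ a ⊎ E₃ c → E₁ a ⊎ (E₂ a × E₃ a)
  hitting-pair _          (inj₁ E₂a) (inj₁ E₃a) = inj₂ (E₂a , E₃a)
  hitting-pair (inj₁ E₁a) _          _          = inj₁ E₁a
  hitting-pair {c = c} (inj₂ E₁c) (inj₂ E₂c) _          = ⊥-elim (E₁∩E₂ c E₁c E₂c)
  hitting-pair {c = c} (inj₂ E₁c) (inj₁ _)   (inj₂ E₃c) = ⊥-elim (E₁∩E₃ c E₁c E₃c)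

  ¬hitting-three-disjoint : ∀ {a c} → Disjoint E₂ E₃ → E₁ a ⊎ E₁ c → E₂ a ⊎ E₂ c → E₃ a ⊎ E₃ c → ⊥
  ¬hitting-three-disjoint {a} {c} E₂∩E₃ h₁ h₂ h₃ with hitting-pair h₁ h₂ h₃ | hitting-pair (swap h₁) (swap h₂) (swap h₃)
  ... | inj₂ (E₂a , E₃a) | _                = E₂∩E₃ a E₂a E₃a
  ... | _                | inj₂ (E₂c , E₃c) = E₂∩E₃ c E₂c E₃c
  ... | inj₁ E₁a         | inj₁ E₁c         = [ E₁∩E₂ a E₁a , E₁∩E₂ c E₁c ]′ h₂

module PartnerGraph {k : ℕ} (p : Fin k → Fin k) where

  open import Data.List.Membership.DecPropositional (_≟_ {k}) using (_∈?_)

  Linked : Fin k → Fin k → Set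
  Linked x y = p x ≡ y ⊎ p y ≡ x

  MaxDegreeTwo : Set
  MaxDegreeTwo = ∀ {x y₁ y₂ y₃} → y₁ ≢ y₂ → y₁ ≢ y₃ → y₂ ≢ y₃ → Linked x y₁ → Linked x y₂ → Linked x y₃ → ⊥

  Edge : Fin k → VSet k
  Edge x z = z ≡ x ⊎ z ≡ p x

  Covers : List (Fin k) → Set
  Covers T = ∀ x → x ∈ T ⊎ p x ∈ T

  cover-hits : ∀ {o a c u} → Covers (o ∷ a ∷ c ∷ []) → u ≢ o → p u ≢ o → Edge u a ⊎ Edge u c
  cover-hits {u = u} C u≢o pu≢o with C u
  ... | inj₁ (here u≡o)                  = ⊥-elim (u≢o u≡o)
  ... | inj₁ (there (here u≡a))          = inj₁ (inj₁ (sym u≡a))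
  ... | inj₁ (there (there (here u≡c)))  = inj₂ (inj₁ (sym u≡c))
  ... | inj₂ (here pu≡o)                 = ⊥-elim (pu≢o pu≡o)
  ... | inj₂ (there (here pu≡a))         = inj₁ (inj₂ (sym pu≡a))
  ... | inj₂ (there (there (here pu≡c))) = inj₂ (inj₂ (sym pu≡c))
  ... | inj₁ (there (there (there ())))
  ... | inj₂ (there (there (there ())))

  module Outside {T : List (Fin k)} (C : Covers T) where

    image-∈ : ∀ {u} → u ∉ T → p u ∈ T
    image-∈ u∉ = [ ⊥-elim ∘ u∉ , id ]′ (C _)

    image-≢ : ∀ {o u} → o ∉ T → u ∉ T → p u ≢ o
    image-≢ o∉ u∉ pu≡o = o∉ (subst (_∈ T) pu≡o (image-∈ u∉))

    edges-disjoint : ∀ {u v} → u ∉ T → v ∉ T → p u ≢ p v → Disjoint (Edge u) (Edge v)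
    edges-disjoint u∉ v∉ pu≢pv z (inj₁ refl) (inj₁ refl) = pu≢pv refl
    edges-disjoint u∉ v∉ pu≢pv z (inj₁ refl) (inj₂ u≡pv) = image-≢ u∉ v∉ (sym u≡pv)
    edges-disjoint u∉ v∉ pu≢pv z (inj₂ refl) (inj₁ pu≡v) = image-≢ v∉ u∉ pu≡v
    edges-disjoint u∉ v∉ pu≢pv z (inj₂ refl) (inj₂ pu≡pv) = pu≢pv pu≡pv

    edges-meet : ∀ {u v} → u ∉ T → v ∉ T → u ≢ v → ∀ {z} → Edge u z → Edge v z → z ≡ p u
    edges-meet u∉ v∉ u≢v (inj₁ refl) (inj₁ u≡v)  = ⊥-elim (u≢v u≡v)
    edges-meet u∉ v∉ u≢v (inj₁ refl) (inj₂ u≡pv) = ⊥-elim (image-≢ u∉ v∉ (sym u≡pv))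
    edges-meet u∉ v∉ u≢v (inj₂ z≡pu) _           = z≡pu

  module _ (max-degree-two : MaxDegreeTwo) (cover : ∀ r → ∃₂ λ a c → Covers (r ∷ a ∷ c ∷ [])) where

    fibre≤2 : ∀ {u₁ u₂ u₃} → u₁ ≢ u₂ → u₁ ≢ u₃ → u₂ ≢ u₃ → p u₂ ≡ p u₁ → p u₃ ≡ p u₁ → ⊥
    fibre≤2 u₁≢u₂ u₁≢u₃ u₂≢u₃ e₂ e₃ = max-degree-two u₁≢u₂ u₁≢u₃ u₂≢u₃ (inj₂ refl) (inj₂ e₂) (inj₂ e₃)

    module _ {r a c : Fin k} (C : Covers (r ∷ a ∷ c ∷ [])) where
      open Outside C

      T : List (Fin k)
      T = r ∷ a ∷ c ∷ []

      ¬three-distinct-images : ∀ {o u₁ u₂ u₃} → o ∉ T → u₁ ∉ T → u₂ ∉ T → u₃ ∉ T → u₁ ≢ o → u₂ ≢ o → u₃ ≢ o →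
                        p u₁ ≢ p u₂ → p u₁ ≢ p u₃ → p u₂ ≢ p u₃ → ⊥
      ¬three-distinct-images o∉ u₁∉ u₂∉ u₃∉ u₁≢o u₂≢o u₃≢o p₁≢p₂ p₁≢p₃ p₂≢p₃ with cover _
      ... | _ , _ , Cₒ = ¬hitting-three-disjoint
        (edges-disjoint u₁∉ u₂∉ p₁≢p₂) (edges-disjoint u₁∉ u₃∉ p₁≢p₃) (edges-disjoint u₂∉ u₃∉ p₂≢p₃)
        (cover-hits Cₒ u₁≢o (image-≢ o∉ u₁∉)) (cover-hits Cₒ u₂≢o (image-≢ o∉ u₂∉)) (cover-hits Cₒ u₃≢o (image-≢ o∉ u₃∉))

      Mates : Fin k → Fin k → Set
      Mates u₁ u₂ = u₁ ∉ T × u₂ ∉ T × u₁ ≢ u₂ × p u₂ ≡ p u₁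

      mates? : ∀ u₁ u₂ → Dec (Mates u₁ u₂)
      mates? u₁ u₂ = ¬? (u₁ ∈? T) ×-dec ¬? (u₂ ∈? T) ×-dec ¬? (u₁ ≟ u₂) ×-dec (p u₂ ≟ p u₁)

      -- Two points must meet the edges of u₂, v₁ and v₂, and only the edges of v₁ and v₂ intersect.
      mate-cover : ∀ {u₁ u₂ v₁ v₂ a′ c′} → Mates u₁ u₂ → Mates v₁ v₂ → p u₁ ≢ p v₁ →
                   Covers (u₁ ∷ a′ ∷ c′ ∷ []) → ∀ {z} → z ∈ a′ ∷ c′ ∷ [] → z ≡ u₂ ⊎ z ≡ p u₁ ⊎ z ≡ p v₁
      mate-cover {u₁} {u₂} {v₁} {v₂} {a′} {c′} (u₁∉ , u₂∉ , u₁≢u₂ , pu₂≡) (v₁∉ , v₂∉ , v₁≢v₂ , pv₂≡) x≢y Cᵤ {z} z∈ =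
        spot (on-edges z∈)
        where
        v≢u₁ : ∀ {v} → p v ≡ p v₁ → v ≢ u₁
        v≢u₁ pv v≡u₁ = x≢y (trans (cong p (sym v≡u₁)) pv)

        hits₂ = cover-hits Cᵤ (u₁≢u₂ ∘ sym) (image-≢ u₁∉ u₂∉)
        hits₃ = cover-hits Cᵤ (v≢u₁ refl) (image-≢ u₁∉ v₁∉)
        hits₄ = cover-hits Cᵤ (v≢u₁ pv₂≡) (image-≢ u₁∉ v₂∉)
        u₂∩v₁ = edges-disjoint u₂∉ v₁∉ (x≢y ∘ trans (sym pu₂≡))
        u₂∩v₂ = edges-disjoint u₂∉ v₂∉ (λ e → x≢y (trans (sym pu₂≡) (trans e pv₂≡)))

        on-edges : z ∈ a′ ∷ c′ ∷ [] → Edge u₂ z ⊎ Edge v₁ z × Edge v₂ z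
        on-edges (here refl)         = hitting-pair u₂∩v₁ u₂∩v₂ hits₂ hits₃ hits₄
        on-edges (there (here refl)) = hitting-pair u₂∩v₁ u₂∩v₂ (swap hits₂) (swap hits₃) (swap hits₄)

        spot : Edge u₂ z ⊎ Edge v₁ z × Edge v₂ z → z ≡ u₂ ⊎ z ≡ p u₁ ⊎ z ≡ p v₁
        spot (inj₁ (inj₁ z≡u₂))     = inj₁ z≡u₂
        spot (inj₁ (inj₂ z≡pu₂))    = inj₂ (inj₁ (trans z≡pu₂ pu₂≡))
        spot (inj₂ (on-v₁ , on-v₂)) = inj₂ (inj₂ (edges-meet v₁∉ v₂∉ v₁≢v₂ on-v₁ on-v₂))

      pair-absorbs : ∀ {u₁ u₂ v₁ v₂ t} → Mates u₁ u₂ → Mates v₁ v₂ → p u₁ ≢ p v₁ →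
                     t ∉ u₁ ∷ u₂ ∷ p u₁ ∷ [] → t ∉ v₁ ∷ v₂ ∷ p v₁ ∷ [] → p t ≡ u₁ ⊎ p t ≡ u₂
      pair-absorbs {u₁} {u₂} {v₁} {v₂} {t} U@(_ , _ , u₁≢u₂ , pu₂≡) V@(_ , _ , v₁≢v₂ , pv₂≡) x≢y t∉U t∉V
        with cover u₁
      ... | a′ , c′ , Cᵤ = locate (Cᵤ t)
        where
        t-off : ¬ (t ≡ u₂ ⊎ t ≡ p u₁ ⊎ t ≡ p v₁)
        t-off (inj₁ t≡u₂)       = t∉U (there (here t≡u₂))
        t-off (inj₂ (inj₁ t≡x)) = t∉U (there (there (here t≡x)))
        t-off (inj₂ (inj₂ t≡y)) = t∉V (there (there (here t≡y)))

        image-at : p t ≡ u₂ ⊎ p t ≡ p u₁ ⊎ p t ≡ p v₁ → p t ≡ u₂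
        image-at (inj₁ pt≡u₂)       = pt≡u₂
        image-at (inj₂ (inj₁ pt≡x)) =
          ⊥-elim (fibre≤2 u₁≢u₂ (t∉U ∘ here ∘ sym) (t∉U ∘ there ∘ here ∘ sym) pu₂≡ pt≡x)
        image-at (inj₂ (inj₂ pt≡y)) =
          ⊥-elim (fibre≤2 v₁≢v₂ (t∉V ∘ here ∘ sym) (t∉V ∘ there ∘ here ∘ sym) pv₂≡ pt≡y)

        locate : t ∈ u₁ ∷ a′ ∷ c′ ∷ [] ⊎ p t ∈ u₁ ∷ a′ ∷ c′ ∷ [] → p t ≡ u₁ ⊎ p t ≡ u₂
        locate (inj₁ (here t≡u₁))  = ⊥-elim (t∉U (here t≡u₁))
        locate (inj₁ (there t∈))   = ⊥-elim (t-off (mate-cover U V x≢y Cᵤ t∈))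
        locate (inj₂ (here pt≡u₁)) = inj₁ pt≡u₁
        locate (inj₂ (there pt∈))  = inj₂ (image-at (mate-cover U V x≢y Cᵤ pt∈))

      module _ (7≤k : 7 ≤ k) where

        fresh : (xs : List (Fin k)) → {True (length xs ≤? 6)} → ∃ (_∉ xs)
        fresh xs {|xs|≤6} = ∃-∉ xs (≤-trans (s≤s (toWitness |xs|≤6)) 7≤k)

        ¬two-mate-pairs : ∀ {u₁ u₂ v₁ v₂} → Mates u₁ u₂ → Mates v₁ v₂ → p u₁ ≢ p v₁ → ⊥
        ¬two-mate-pairs {u₁} {u₂} {v₁} {v₂} U@(_ , _ , _ , pu₂≡) V@(_ , _ , _ , pv₂≡) x≢y
          with fresh ((u₁ ∷ u₂ ∷ p u₁ ∷ []) ++ (v₁ ∷ v₂ ∷ p v₁ ∷ []))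
        ... | t , t∉ = x≢y (trans (sym (in-U (pair-absorbs U V x≢y t∉U t∉V)))
                                  (in-V (pair-absorbs V U (x≢y ∘ sym) t∉V t∉U)))
          where
          t∉U = t∉ ∘ ∈-++⁺ˡ
          t∉V = t∉ ∘ ∈-++⁺ʳ (u₁ ∷ u₂ ∷ p u₁ ∷ [])
          in-U : p t ≡ u₁ ⊎ p t ≡ u₂ → p (p t) ≡ p u₁
          in-U (inj₁ e) = cong p e
          in-U (inj₂ e) = trans (cong p e) pu₂≡
          in-V : p t ≡ v₁ ⊎ p t ≡ v₂ → p (p t) ≡ p v₁
          in-V (inj₁ e) = cong p e
          in-V (inj₂ e) = trans (cong p e) pv₂≡

        ¬Mates : ∀ {u₁ u₂} → ¬ Mates u₁ u₂
        ¬Mates {u₁} {u₂} U@(u₁∉ , u₂∉ , u₁≢u₂ , pu₂≡) with fresh (u₁ ∷ u₂ ∷ T)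
        ... | v₁ , v₁∉ with p v₁ ≟ p u₁ | any? (mates? v₁)
        ...   | yes pv₁≡ | _            = fibre≤2 u₁≢u₂ (v₁∉ ∘ here ∘ sym) (v₁∉ ∘ there ∘ here ∘ sym) pu₂≡ pv₁≡
        ...   | no pv₁≢  | yes (_ , V)  = ¬two-mate-pairs U V (pv₁≢ ∘ sym)
        ...   | no pv₁≢  | no ¬V with fresh (v₁ ∷ u₁ ∷ u₂ ∷ T)
        ...     | w , w∉ = ¬three-distinct-images u₂∉ u₁∉ (v₁∉ ∘ there ∘ there) (w∉ ∘ there ∘ there ∘ there)
                    (u₁≢u₂) (v₁∉ ∘ there ∘ here) (w∉ ∘ there ∘ there ∘ here)
                    (pv₁≢ ∘ sym)
                    (λ pu₁≡pw → fibre≤2 u₁≢u₂ (w∉ ∘ there ∘ here ∘ sym) (w∉ ∘ there ∘ there ∘ here ∘ sym) pu₂≡ (sym pu₁≡pw))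
                    (λ pv₁≡pw → ¬V (w , v₁∉ ∘ there ∘ there , w∉ ∘ there ∘ there ∘ there , w∉ ∘ here ∘ sym , sym pv₁≡pw))

        mates-exist : ¬ (∀ {u₁ u₂} → ¬ Mates u₁ u₂)
        mates-exist ¬mates with fresh T
        ... | o₁ , o₁∉ with fresh (o₁ ∷ T)
        ... | o₂ , o₂∉ with fresh (o₂ ∷ o₁ ∷ T)
        ... | o₃ , o₃∉ with fresh (o₃ ∷ o₂ ∷ o₁ ∷ T)
        ... | o₄ , o₄∉ = ¬three-distinct-images o₁∉ (o₂∉ ∘ there) (o₃∉ ∘ there ∘ there) (o₄∉ ∘ there ∘ there ∘ there)
                           (o₂∉ ∘ here) (o₃∉ ∘ there ∘ here) (o₄∉ ∘ there ∘ there ∘ here)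
                           (images-≢ (o₂∉ ∘ there) (o₃∉ ∘ there ∘ there) (o₃∉ ∘ here))
                           (images-≢ (o₂∉ ∘ there) (o₄∉ ∘ there ∘ there ∘ there) (o₄∉ ∘ there ∘ here))
                           (images-≢ (o₃∉ ∘ there ∘ there) (o₄∉ ∘ there ∘ there ∘ there) (o₄∉ ∘ here))
          where
          images-≢ : ∀ {u v} → u ∉ T → v ∉ T → v ≢ u → p u ≢ p v
          images-≢ u∉ v∉ v≢u pu≡pv = ¬mates (u∉ , v∉ , v≢u ∘ sym , sym pu≡pv)

    size≤6 : k ≤ 6
    size≤6 with k ≤? 6
    ... | yes k≤6 = k≤6
    ... | no k≰6 with cover (proj₁ (∃-∉ [] (≤-trans (s≤s z≤n) (≰⇒> k≰6))))
    ...   | _ , _ , C with any? (λ u₁ → any? (mates? C u₁))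
    ...     | yes (_ , _ , M) = ⊥-elim (¬Mates C (≰⇒> k≰6) M)
    ...     | no ¬M           = ⊥-elim (mates-exist C (≰⇒> k≰6) (λ M → ¬M (_ , _ , M)))

module Windows {A : Set} (P : A → A → A → Set) where

  Run : A × A → List A → A × A → Set
  Run s       []       t = s ≡ t
  Run (a , b) (c ∷ cs) t = P a b c × Run (b , c) cs t

  run? : DecidableEquality A → (∀ a b c → Dec (P a b c)) → ∀ s cs t → Dec (Run s cs t)
  run? _≟ₐ_ P? s       []       t = ≡-dec _≟ₐ_ _≟ₐ_ s t
  run? _≟ₐ_ P? (a , b) (c ∷ cs) t = P? a b c ×-dec run? _≟ₐ_ P? (b , c) cs t

  Run-++ : ∀ {s t u} xs {ys} → Run s xs t → Run t ys u → Run s (xs ++ ys) u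
  Run-++ []       refl       r′ = r′
  Run-++ (x ∷ xs) (Pabx , r) r′ = Pabx , Run-++ xs r r′

  Run-repeat : ∀ {s ℓ} → Run s ℓ s → ∀ j → Run s (concat (replicate j ℓ)) s
  Run-repeat r ℕ.zero    = refl
  Run-repeat r (ℕ.suc j) = Run-++ _ r (Run-repeat r j)

module Indexing {A : Set} (default : A) where

  _!_ : List A → ℕ → A
  []       ! _       = default
  (x ∷ xs) ! ℕ.zero  = x
  (x ∷ xs) ! ℕ.suc i = xs ! i

  !-++ˡ : ∀ xs {ys} i → i < length xs → (xs ++ ys) ! i ≡ xs ! i
  !-++ˡ (x ∷ xs) ℕ.zero    _         = refl
  !-++ˡ (x ∷ xs) (ℕ.suc i) (s≤s i<n) = !-++ˡ xs i i<n

  !-++ʳ : ∀ xs {ys} i → (xs ++ ys) ! (i + length xs) ≡ ys ! i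
  !-++ʳ []       {ys} i = cong (ys !_) (+-identityʳ i)
  !-++ʳ (x ∷ xs) i rewrite +-suc i (length xs) = !-++ʳ xs i

  Run⇒windows : ∀ {P : A → A → A → Set} {a b t} cs → Windows.Run P (a , b) cs t → ∀ i → i < length cs →
                P ((a ∷ b ∷ cs) ! i) ((a ∷ b ∷ cs) ! ℕ.suc i) ((a ∷ b ∷ cs) ! ℕ.suc (ℕ.suc i))
  Run⇒windows (c ∷ cs) (Pabc , _) ℕ.zero    _         = Pabc
  Run⇒windows (c ∷ cs) (_ , r)    (ℕ.suc i) (s≤s i<n) = Run⇒windows cs r i i<n

module LabelWindows {k : ℕ} (pr : Fin k → Fin k) where

  InPair : Fin k → Fin k → Set
  InPair i x = x ≡ i ⊎ x ≡ pr i

  inPair? : ∀ i x → Dec (InPair i x)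
  inPair? i x = (x ≟ i) ⊎-dec (x ≟ pr i)

  -- For the labels a , b , c of prev v , v , next v: the first component is the at-most-one-neighbour
  -- condition for class i at v, the second makes class i ∪ class (pr i) perfectly dominating at v.
  PrcWindow : Fin k → Fin k → Fin k → Set
  PrcWindow a b c = ∀ i → (a ≡ i → c ≡ i → b ≡ i) ×
                          (¬ InPair i b → (InPair i a ⊎ InPair i c) × ¬ (InPair i a × InPair i c))

  prcWindow? : ∀ a b c → Dec (PrcWindow a b c)
  prcWindow? a b c = all? λ i →
    (a ≟ i →-dec (c ≟ i →-dec b ≟ i)) ×-dec
    (¬? (inPair? i b) →-dec ((inPair? i a ⊎-dec inPair? i c) ×-dec ¬? (inPair? i a ×-dec inPair? i c)))

  Avoids : Fin k → Fin k → Fin k → Fin k → Set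
  Avoids i a b c = a ≢ i × b ≢ i × c ≢ i

  avoids? : ∀ i a b c → Dec (Avoids i a b c)
  avoids? i a b c = ¬? (a ≟ i) ×-dec ¬? (b ≟ i) ×-dec ¬? (c ≟ i)

module Cycle (m : ℕ) where

  Vertex : Set
  Vertex = Fin (ℕ.suc m)

  Adj : Vertex → Vertex → Set
  Adj = CycleAdj (ℕ.suc m)

  next : Vertex → Vertex
  next v with ℕ.suc (toℕ v) ℕ.<? ℕ.suc m
  ... | yes v+1<n = fromℕ< v+1<n
  ... | no  _     = zero

  prev : Vertex → Vertex
  prev zero    = fromℕ m
  prev (suc v) = inject₁ v

  toℕ-next : ∀ v → toℕ (next v) ≡ ℕ.suc (toℕ v) ⊎ (toℕ v ≡ m × toℕ (next v) ≡ 0)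
  toℕ-next v with ℕ.suc (toℕ v) ℕ.<? ℕ.suc m
  ... | yes v+1<n = inj₁ (toℕ-fromℕ< v+1<n)
  ... | no  v+1≮n = inj₂ (≤-antisym (toℕ≤pred[n] v) (≤-pred (≮⇒≥ v+1≮n)) , refl)

  next-prev : ∀ v → next (prev v) ≡ v
  next-prev zero with toℕ-next (fromℕ m)
  ... | inj₁ e = contradiction (trans e (cong ℕ.suc (toℕ-fromℕ m))) (<⇒≢ (toℕ<n _))
  ... | inj₂ (_ , e) = toℕ-injective e
  next-prev (suc v) with toℕ-next (inject₁ v)
  ... | inj₁ e = toℕ-injective (trans e (cong ℕ.suc (toℕ-inject₁ v)))
  ... | inj₂ (e , _) = contradiction (trans (sym (toℕ-inject₁ v)) e) (<⇒≢ (toℕ<n v))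

  step⇒next : ∀ {u v} → ℕ.suc (toℕ u) ≡ toℕ v ⊎ (ℕ.suc (toℕ u) ≡ ℕ.suc m × toℕ v ≡ 0) → v ≡ next u
  step⇒next {u} {v} step with toℕ-next u | step
  ... | inj₁ e       | inj₁ e′       = toℕ-injective (trans (sym e′) (sym e))
  ... | inj₁ e       | inj₂ (e′ , _) = contradiction (trans e e′) (<⇒≢ (toℕ<n (next u)))
  ... | inj₂ (e , _) | inj₁ e′       = contradiction (trans (cong ℕ.suc (sym e)) e′) (<⇒≢ (toℕ<n v) ∘ sym)
  ... | inj₂ (_ , z) | inj₂ (_ , z′) = toℕ-injective (trans z′ (sym z))

  next-injective : ∀ {u v} → next u ≡ next v → u ≡ v
  next-injective {u} {v} e with toℕ-next u | toℕ-next v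
  ... | inj₁ a       | inj₁ b       = toℕ-injective (suc-injective (trans (sym a) (trans (cong toℕ e) b)))
  ... | inj₁ a       | inj₂ (_ , b) = contradiction (trans (sym a) (trans (cong toℕ e) b)) λ ()
  ... | inj₂ (_ , a) | inj₁ b       = contradiction (trans (sym b) (trans (cong toℕ (sym e)) a)) λ ()
  ... | inj₂ (a , _) | inj₂ (b , _) = toℕ-injective (trans a (sym b))

  prev-next : ∀ v → prev (next v) ≡ v
  prev-next v = next-injective (next-prev (next v))

  adj-next : ∀ u → Adj u (next u)
  adj-next u with toℕ-next u
  ... | inj₁ e       = inj₁ (sym e)
  ... | inj₂ (e , z) = inj₂ (inj₂ (inj₁ (cong ℕ.suc e , z)))

  adj-sym : ∀ {u v} → Adj u v → Adj v u
  adj-sym (inj₁ e)                = inj₂ (inj₁ e)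
  adj-sym (inj₂ (inj₁ e))         = inj₁ e
  adj-sym (inj₂ (inj₂ (inj₁ w)))  = inj₂ (inj₂ (inj₂ w))
  adj-sym (inj₂ (inj₂ (inj₂ w)))  = inj₂ (inj₂ (inj₁ w))

  adj-prev : ∀ u → Adj u (prev u)
  adj-prev u = adj-sym (subst (Adj (prev u)) (next-prev u) (adj-next (prev u)))

  next⇒prev : ∀ {u v} → u ≡ next v → v ≡ prev u
  next⇒prev refl = sym (prev-next _)

  adj⇒next⊎prev : ∀ {u v} → Adj u v → v ≡ next u ⊎ v ≡ prev u
  adj⇒next⊎prev (inj₁ e)               = inj₁ (step⇒next (inj₁ e))
  adj⇒next⊎prev (inj₂ (inj₁ e))        = inj₂ (next⇒prev (step⇒next (inj₁ e)))
  adj⇒next⊎prev (inj₂ (inj₂ (inj₁ w))) = inj₁ (step⇒next (inj₂ w))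
  adj⇒next⊎prev (inj₂ (inj₂ (inj₂ w))) = inj₂ (next⇒prev (step⇒next (inj₂ w)))

  prev⊎next⇒nbr : ∀ {S : VSet (ℕ.suc m)} {v} → S (prev v) ⊎ S (next v) → ∃ λ u → S u × Adj v u
  prev⊎next⇒nbr {v = v} (inj₁ s) = prev v , s , adj-prev v
  prev⊎next⇒nbr {v = v} (inj₂ s) = next v , s , adj-next v

  ¬both⇒atMostOneNbr : ∀ {S : VSet (ℕ.suc m)} {v} → ¬ (S (prev v) × S (next v)) → AtMostOneNbr Adj S v
  ¬both⇒atMostOneNbr {v = v} ¬both u w Su Sw v~u v~w with adj⇒next⊎prev v~u | adj⇒next⊎prev v~w
  ... | inj₁ refl | inj₁ refl = refl
  ... | inj₂ refl | inj₂ refl = refl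
  ... | inj₁ refl | inj₂ refl = ⊥-elim (¬both (Sw , Su))
  ... | inj₂ refl | inj₁ refl = ⊥-elim (¬both (Su , Sw))

  toℕ-iterate-from-zero : ∀ d → d ≤ m → toℕ (iterate next zero d) ≡ d
  toℕ-iterate-from-zero ℕ.zero    _   = refl
  toℕ-iterate-from-zero (ℕ.suc d) d<m rewrite iterate-suc next zero d with toℕ-next (iterate next zero d)
  ... | inj₁ e       = trans e (cong ℕ.suc (toℕ-iterate-from-zero d (<⇒≤ d<m)))
  ... | inj₂ (e , _) = contradiction (trans (sym (toℕ-iterate-from-zero d (<⇒≤ d<m))) e) (<⇒≢ d<m)

  iterate-from-zero : ∀ v → iterate next zero (toℕ v) ≡ v
  iterate-from-zero v = toℕ-injective (toℕ-iterate-from-zero (toℕ v) (toℕ≤pred[n] v))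

  iterate-around : iterate next zero (ℕ.suc m) ≡ zero
  iterate-around = begin
    iterate next zero (ℕ.suc m)  ≡⟨ iterate-suc next zero m ⟩
    next (iterate next zero m)   ≡⟨ cong next (toℕ-injective (trans (toℕ-iterate-from-zero m ≤-refl) (sym (toℕ-fromℕ m)))) ⟩
    next (prev zero)             ≡⟨ next-prev zero ⟩
    zero                         ∎

  iterate-to-zero : ∀ u → iterate next u (ℕ.suc m ∸ toℕ u) ≡ zero
  iterate-to-zero u = begin
    iterate next u (ℕ.suc m ∸ toℕ u)
      ≡⟨ cong (λ w → iterate next w (ℕ.suc m ∸ toℕ u)) (sym (iterate-from-zero u)) ⟩
    iterate next (iterate next zero (toℕ u)) (ℕ.suc m ∸ toℕ u)
      ≡⟨ sym (iterate-+ next zero (toℕ u) (ℕ.suc m ∸ toℕ u)) ⟩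
    iterate next zero (toℕ u + (ℕ.suc m ∸ toℕ u))
      ≡⟨ cong (iterate next zero) (m+[n∸m]≡n (<⇒≤ (toℕ<n u))) ⟩
    iterate next zero (ℕ.suc m)
      ≡⟨ iterate-around ⟩
    zero ∎

  iterate-reaches : ∀ u v → ∃ λ d → iterate next u d ≡ v
  iterate-reaches u v = (ℕ.suc m ∸ toℕ u) + toℕ v , (begin
    iterate next u ((ℕ.suc m ∸ toℕ u) + toℕ v)               ≡⟨ iterate-+ next u (ℕ.suc m ∸ toℕ u) (toℕ v) ⟩
    iterate next (iterate next u (ℕ.suc m ∸ toℕ u)) (toℕ v)  ≡⟨ cong (λ w → iterate next w (toℕ v)) (iterate-to-zero u) ⟩
    iterate next zero (toℕ v)                                ≡⟨ iterate-from-zero v ⟩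
    v                                                        ∎)

  next-closed⇒all : (Q : VSet (ℕ.suc m)) → (∀ v → Q v → Q (next v)) → ∀ {u} → Q u → ∀ v → Q v
  next-closed⇒all Q closed {u} Qu v with iterate-reaches u v
  ... | d , refl = along d u Qu
    where
    along : ∀ d u → Q u → Q (iterate next u d)
    along ℕ.zero    u Qu = Qu
    along (ℕ.suc d) u Qu = along d (next u) (closed u Qu)

  -- iterate next · d commutes with next, so a fixed vertex makes every vertex fixed, but 0 moves to d.
  iterate-next-≢ : ∀ d v → 0 < d → d ≤ m → iterate next v d ≢ v
  iterate-next-≢ d v 0<d d≤m v-fixed = <⇒≢ 0<d (begin
    0                             ≡⟨ cong toℕ (sym (all-fixed zero)) ⟩
    toℕ (iterate next zero d)     ≡⟨ toℕ-iterate-from-zero d d≤m ⟩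
    d                             ∎)
    where
    all-fixed : ∀ w → iterate next w d ≡ w
    all-fixed = next-closed⇒all (λ w → iterate next w d ≡ w) (λ w e → trans (iterate-suc next w d) (cong next e)) v-fixed

  Free : VSet (ℕ.suc m) → Vertex → Set
  Free S c = ¬ S c × ¬ S (next c) × ¬ S (next (next c))

  Gap : VSet (ℕ.suc m) → Vertex → Set
  Gap S c = Free S c × S (next (next (next c)))

  module _ {S : VSet (ℕ.suc m)} (S? : Decidable S) where

    free? : Decidable (Free S)
    free? c = ¬? (S? c) ×-dec ¬? (S? (next c)) ×-dec ¬? (S? (next (next c)))

    ¬dominating⇒free : ¬ Dominating Adj S → ∃ (Free S)
    ¬dominating⇒free ¬dom with any? free?
    ... | yes free = free
    ... | no ¬free = ⊥-elim (¬dom dominating)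
      where
      dominating : Dominating Adj S
      dominating v v∉ with S? (prev v) | S? (next v)
      ... | yes Sp | _      = prev⊎next⇒nbr (inj₁ Sp)
      ... | no _   | yes Sn = prev⊎next⇒nbr (inj₂ Sn)
      ... | no ¬Sp | no ¬Sn =
        ⊥-elim (¬free (prev v , ¬Sp , subst (λ w → ¬ S w × ¬ S (next w)) (sym (next-prev v)) (v∉ , ¬Sn)))

    -- Without a gap, three consecutive vertices outside S would propagate all around the cycle.
    gap : ∀ {e} → S e → ¬ Dominating Adj S → ∃ (Gap S)
    gap {e} Se ¬dom with any? (λ c → free? c ×-dec S? (next (next (next c))))
    ... | yes found = found
    ... | no ¬gap   = ⊥-elim (proj₁ (next-closed⇒all (Free S) shift (proj₂ (¬dominating⇒free ¬dom)) e) Se)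
      where
      shift : ∀ c → Free S c → Free S (next c)
      shift c (¬S₀ , ¬S₁ , ¬S₂) = ¬S₁ , ¬S₂ , λ S₃ → ¬gap (c , (¬S₀ , ¬S₁ , ¬S₂) , S₃)

  gap-partner : 2 ≤ m → ∀ {A B : VSet (ℕ.suc m)} → Decidable B → PerfectDominating Adj (A ∪ B) →
                ∀ {c} → Gap A c → B c ⊎ B (next (next c))
  gap-partner 2≤m {A} {B} B? perfect {c} ((¬A₀ , ¬A₁ , ¬A₂) , A₃) with B? (next (next c))
  ... | yes B₂ = inj₂ B₂
  ... | no ¬B₂ = inj₁ (prev-in-B (proj₁ (perfect (next c) x₁∉)))
    where
    x₂∉ : ¬ (A ∪ B) (next (next c))
    x₂∉ = [ ¬A₂ , ¬B₂ ]′
    -- next (next c) ∉ A ∪ B already has its neighbour next (next (next c)) in A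
    x₁∉ : ¬ (A ∪ B) (next c)
    x₁∉ x₁∈ = iterate-next-≢ 2 (next c) (s≤s z≤n) 2≤m (sym
      (proj₂ (perfect _ x₂∉) (next c) _ x₁∈ (inj₁ A₃) (adj-sym (adj-next (next c))) (adj-next _)))
    prev-in-B : (∃ λ u → (A ∪ B) u × Adj (next c) u) → B c
    prev-in-B (u , u∈ , x₁~u) with adj⇒next⊎prev x₁~u
    ... | inj₁ refl = ⊥-elim (x₂∉ u∈)
    ... | inj₂ refl = [ ⊥-elim ∘ ¬A₀ , id ]′ (subst (A ∪ B) (prev-next c) u∈)

  singleton-¬dominating : 3 ≤ m → ∀ {S} → IsSingleton Adj S → ¬ Dominating Adj S
  singleton-¬dominating 3≤m {S} (u , S≐u) dom with dom (next (next u)) far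
    where
    far : ¬ S (next (next u))
    far s = iterate-next-≢ 2 u (s≤s z≤n) (≤-trans (n≤1+n 2) 3≤m) (proj₁ (S≐u _) s)
  ... | w , Sw , w₂~w with proj₁ (S≐u w) Sw
  ... | refl with adj⇒next⊎prev w₂~w
  ...   | inj₁ e = iterate-next-≢ 3 w (s≤s z≤n) 3≤m (sym e)
  ...   | inj₂ e = iterate-next-≢ 1 w (s≤s z≤n) (≤-trans (s≤s z≤n) 3≤m) (sym (trans e (prev-next (next w))))

  module PrcPartition (3≤m : 3 ≤ m) {k} (π : Partition Adj k) (prc : IsPrcPartition Adj π) where

    coalition-partner : ∀ i → ∃ λ j → PerfectCoalition Adj (Class π i) (Class π j)
    coalition-partner i with prc i
    ... | inj₁ (singleton , dominating) = ⊥-elim (singleton-¬dominating 3≤m singleton dominating)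
    ... | inj₂ coalition                = coalition

    partner : Fin k → Fin k
    partner i = proj₁ (coalition-partner i)

    open PartnerGraph partner

    ¬dominating : ∀ i → ¬ Dominating Adj (Class π i)
    ¬dominating i = proj₁ (proj₂ (proj₂ (coalition-partner i)))

    perfect : ∀ i → PerfectDominating Adj (Class π i ∪ Class π (partner i))
    perfect i = proj₂ (proj₂ (proj₂ (proj₂ (proj₂ (proj₂ (coalition-partner i))))))

    linked-perfect : ∀ {x y} → Linked x y → PerfectDominating Adj (Class π x ∪ Class π y)
    linked-perfect (inj₁ refl) = perfect _
    linked-perfect (inj₂ refl) = ∪-comm-perfectDominating (perfect _)

    class? : ∀ i → Decidable (Class π i)
    class? i v = cls π v ≟ i

    max-degree-two : MaxDegreeTwo
    max-degree-two {x} y₁≢y₂ y₁≢y₃ y₂≢y₃ x~y₁ x~y₂ x~y₃ with surj π x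
    ... | v , v∈x with gap (class? x) v∈x (¬dominating x)
    ...   | c , c-gap = ¬hitting-three-disjoint (apart y₁≢y₂) (apart y₁≢y₃) (apart y₂≢y₃)
                          (meets x~y₁) (meets x~y₂) (meets x~y₃)
      where
      apart : ∀ {y y′} → y ≢ y′ → Disjoint (_≡ y) (_≡ y′)
      apart y≢y′ z refl z≡y′ = y≢y′ z≡y′
      meets : ∀ {y} → Linked x y → cls π c ≡ y ⊎ cls π (next (next c)) ≡ y
      meets x~y = gap-partner (≤-trans (n≤1+n 2) 3≤m) (class? _) (linked-perfect x~y) c-gap

    local-cover : ∀ r → ∃₂ λ a c → Covers (r ∷ a ∷ c ∷ [])
    local-cover r with surj π r
    ... | v , refl = cls π (prev v) , cls π (next v) , covered
      where
      covered : Covers (cls π v ∷ cls π (prev v) ∷ cls π (next v) ∷ [])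
      covered X with cls π v ≟ X | cls π v ≟ partner X
      ... | yes v∈X | _        = inj₁ (here (sym v∈X))
      ... | no _    | yes v∈pX = inj₂ (here (sym v∈pX))
      ... | no v∉X  | no v∉pX with proj₁ (perfect X v [ v∉X , v∉pX ]′)
      ...   | u , u∈ , v~u with adj⇒next⊎prev v~u | u∈
      ...     | inj₁ refl | inj₁ e = inj₁ (there (there (here (sym e))))
      ...     | inj₁ refl | inj₂ e = inj₂ (there (there (here (sym e))))
      ...     | inj₂ refl | inj₁ e = inj₁ (there (here (sym e)))
      ...     | inj₂ refl | inj₂ e = inj₂ (there (here (sym e)))

  -- g (suc i) is the label of vertex i, padded by the label of vertex m in front and of vertex 0 behind.
  module Periodic {A : Set} (g : ℕ → A) (wrap₀ : g (ℕ.suc m) ≡ g 0) (wrap₁ : g (ℕ.suc (ℕ.suc m)) ≡ g 1) where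

    label : Vertex → A
    label v = g (ℕ.suc (toℕ v))

    label-prev : ∀ v → label (prev v) ≡ g (toℕ v)
    label-prev zero    = trans (cong (g ∘ ℕ.suc) (toℕ-fromℕ m)) wrap₀
    label-prev (suc v) = cong (g ∘ ℕ.suc) (toℕ-inject₁ v)

    label-next : ∀ v → label (next v) ≡ g (ℕ.suc (ℕ.suc (toℕ v)))
    label-next v with toℕ-next v
    ... | inj₁ e       = cong (g ∘ ℕ.suc) e
    ... | inj₂ (e , z) = trans (cong (g ∘ ℕ.suc) z) (trans (sym wrap₁) (cong (g ∘ ℕ.suc ∘ ℕ.suc) (sym e)))

  module _ {k} (pr : Fin k → Fin k) where
    open LabelWindows pr

    labelling-prc : (∀ i → pr i ≢ i) → (lab : Vertex → Fin k) →
                    (∀ v → PrcWindow (lab (prev v)) (lab v) (lab (next v))) →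
                    (∀ i → ∃ λ v → Avoids i (lab (prev v)) (lab v) (lab (next v))) →
                    (∀ i → ∃ λ v → lab v ≡ i) →
                    HasPrcPartition Adj k
    labelling-prc pr-≢ lab window avoided onto = π , λ i → inj₂ (pr i , coalition i)
      where
      π : Partition Adj k
      π = record { cls = lab ; surj = onto }

      ¬dominating : ∀ i → ¬ Dominating Adj (Class π i)
      ¬dominating i dom with avoided i
      ... | v , ¬prev , ¬here , ¬next with dom v ¬here
      ...   | u , u∈ , v~u with adj⇒next⊎prev v~u
      ...     | inj₁ refl = ¬next u∈
      ...     | inj₂ refl = ¬prev u∈

      atMostOne : ∀ i v → ¬ Class π i v → AtMostOneNbr Adj (Class π i) v
      atMostOne i v v∉ = ¬both⇒atMostOneNbr λ (p∈ , n∈) → v∉ (proj₁ (window v i) p∈ n∈)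

      perfect : ∀ i → PerfectDominating Adj (Class π i ∪ Class π (pr i))
      perfect i v v∉ = prev⊎next⇒nbr (proj₁ exactly-one) , ¬both⇒atMostOneNbr (proj₂ exactly-one)
        where
        exactly-one = proj₂ (window v i) v∉

      coalition : ∀ i → PerfectCoalition Adj (Class π i) (Class π (pr i))
      coalition i = (λ v v∈ v∈′ → pr-≢ i (trans (sym v∈′) v∈)) ,
                    ¬dominating i , ¬dominating (pr i) , atMostOne i , atMostOne (pr i) , perfect i

prc-size≤6 : ∀ {n k} → 4 ≤ n → HasPrcPartition (CycleAdj n) k → k ≤ 6
prc-size≤6 {ℕ.suc m} (s≤s 3≤m) (π , prc) = size≤6 max-degree-two local-cover
  where
  open Cycle.PrcPartition m 3≤m π prc
  open PartnerGraph partner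

length-concat-replicate : ∀ {A : Set} j (ℓ : List A) → length (concat (replicate j ℓ)) ≡ j * length ℓ
length-concat-replicate ℕ.zero    ℓ = refl
length-concat-replicate (ℕ.suc j) ℓ = trans (length-++ ℓ) (cong (length ℓ +_) (length-concat-replicate j ℓ))

module Pumping {k} (pr : Fin k → Fin k) (a b : Fin k) (u ℓ : List (Fin k)) (s : Fin k × Fin k) where
  open LabelWindows pr
  open Windows PrcWindow
  open Indexing a

  start : List (Fin k)
  start = a ∷ b ∷ u

  -- The cyclic words b ∷ u ++ ℓ ^ j ++ a ∷ [], read with the last two letters as state: u leads from
  -- (a , b) to s, ℓ is a loop at s, and reading a , b from s closes the cycle.
  record Pumpable : Set where
    constructor pumpable
    field
      partner-≢ : ∀ i → pr i ≢ i
      prefix    : Run (a , b) u s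
      loop      : Run s ℓ s
      closing   : Run s (a ∷ b ∷ []) (a , b)
      avoided   : ∀ i → ∃ λ (c : Fin (length u)) →
                    Avoids i (start ! toℕ c) (start ! ℕ.suc (toℕ c)) (start ! ℕ.suc (ℕ.suc (toℕ c)))
      onto      : ∀ i → ∃ λ (c : Fin (length (b ∷ u))) → (b ∷ u) ! toℕ c ≡ i

  pumpable? : Dec Pumpable
  pumpable? = map′ (λ (nf , p , l , c , av , on) → pumpable nf p l c av on)
                   (λ P → let open Pumpable P in partner-≢ , prefix , loop , closing , avoided , onto)
    (all? (λ i → ¬? (pr i ≟ i)) ×-dec run′? (a , b) u s ×-dec run′? s ℓ s ×-dec run′? s (a ∷ b ∷ []) (a , b) ×-dec
     all? (λ i → any? λ c → avoids? i _ _ _) ×-dec all? (λ i → any? λ c → (b ∷ u) ! toℕ c ≟ i))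
    where
    run′? = run? _≟_ prcWindow?

  module Pumped (P : Pumpable) (j : ℕ) where
    open Pumpable P

    zs : List (Fin k)
    zs = u ++ concat (replicate j ℓ)

    open Cycle (ℕ.suc (length zs))

    cyclic : List (Fin k)
    cyclic = zs ++ a ∷ b ∷ []

    g : ℕ → Fin k
    g i = (a ∷ b ∷ cyclic) ! i

    open Periodic g (!-++ʳ (a ∷ b ∷ zs) 0) (!-++ʳ (a ∷ b ∷ zs) 1)

    run : Run (a , b) cyclic (a , b)
    run = Run-++ zs (Run-++ u prefix (Run-repeat loop j)) closing

    |cyclic| : length cyclic ≡ 2 + length zs
    |cyclic| = trans (length-++ zs) (+-comm (length zs) 2)

    window : ∀ v → PrcWindow (label (prev v)) (label v) (label (next v))
    window v = subst₂ (λ x z → PrcWindow x (label v) z) (sym (label-prev v)) (sym (label-next v))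
      (Run⇒windows cyclic run (toℕ v) (subst (toℕ v <_) (sym |cyclic|) (toℕ<n v)))

    g-start : ∀ i → i < length start → g i ≡ start ! i
    g-start i i<n = trans (cong (λ w → (a ∷ b ∷ w) ! i) (++-assoc u (concat (replicate j ℓ)) (a ∷ b ∷ [])))
                          (!-++ˡ start {concat (replicate j ℓ) ++ a ∷ b ∷ []} i i<n)

    vertex : ∀ c → c ≤ length u → ∃ λ v → toℕ v ≡ c
    vertex c c≤u = fromℕ< (s≤s (m≤n⇒m≤1+n (≤-trans c≤u (length-++-≤ˡ u {concat (replicate j ℓ)})))) , toℕ-fromℕ< _

    avoided′ : ∀ i → ∃ λ v → Avoids i (label (prev v)) (label v) (label (next v))
    avoided′ i with avoided i
    ... | c , ¬₀ , ¬₁ , ¬₂ with vertex (toℕ c) (<⇒≤ (toℕ<n c))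
    ...   | v , v≡c = v , ¬₀ ∘ trans (sym at₀) , ¬₁ ∘ trans (sym at₁) , ¬₂ ∘ trans (sym at₂)
      where
      c<u = toℕ<n c
      at₀ : label (prev v) ≡ start ! toℕ c
      at₀ = trans (label-prev v) (trans (cong g v≡c) (g-start _ (m≤n⇒m≤1+n (m≤n⇒m≤1+n c<u))))
      at₁ : label v ≡ start ! ℕ.suc (toℕ c)
      at₁ = trans (cong (g ∘ ℕ.suc) v≡c) (g-start _ (s≤s (m≤n⇒m≤1+n c<u)))
      at₂ : label (next v) ≡ start ! ℕ.suc (ℕ.suc (toℕ c))
      at₂ = trans (label-next v) (trans (cong (g ∘ ℕ.suc ∘ ℕ.suc) v≡c) (g-start _ (s≤s (s≤s c<u))))

    onto′ : ∀ i → ∃ λ v → label v ≡ i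
    onto′ i with onto i
    ... | c , c↦i with vertex (toℕ c) (≤-pred (toℕ<n c))
    ...   | v , v≡c = v , trans (cong (g ∘ ℕ.suc) v≡c) (trans (g-start _ (s≤s (toℕ<n c))) c↦i)

    prc : HasPrcPartition Adj k
    prc = labelling-prc pr partner-≢ label window avoided′ onto′

  pumped-prc : Pumpable → ∀ j → HasPrcPartition (CycleAdj (2 + length u + j * length ℓ)) k
  pumped-prc P j = subst (λ n → HasPrcPartition (CycleAdj n) k) |word| (Pumped.prc P j)
    where
    |word| : 2 + length (u ++ concat (replicate j ℓ)) ≡ 2 + length u + j * length ℓ
    |word| = cong (2 +_) (trans (length-++ u) (cong (length u +_) (length-concat-replicate j ℓ)))

Label : Set
Label = Fin 6

pr₀ : Label → Label
pr₀ zero                                = # 3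
pr₀ (suc zero)                          = # 4
pr₀ (suc (suc zero))                    = # 5
pr₀ (suc (suc (suc zero)))              = # 0
pr₀ (suc (suc (suc (suc zero))))        = # 1
pr₀ (suc (suc (suc (suc (suc zero))))) = # 2

pr₁ : Label → Label
pr₁ zero                                = # 1
pr₁ (suc zero)                          = # 0
pr₁ (suc (suc zero))                    = # 0
pr₁ (suc (suc (suc zero)))              = # 4
pr₁ (suc (suc (suc (suc zero))))        = # 3
pr₁ (suc (suc (suc (suc (suc zero))))) = # 3

-- The cyclic words 0 1 2 (3 4 5)^(j+2), 0 1 3 2 0 3 5 0 4 (5 0 4)^j 3 and 0 0 3 3 0 1 3 2 0 3 5 0 4 (5 0 4)^j 3.
module Family₀ = Pumping pr₀ (# 5) (# 0) (# 1 ∷ # 2 ∷ # 3 ∷ # 4 ∷ # 5 ∷ # 3 ∷ # 4 ∷ []) (# 5 ∷ # 3 ∷ # 4 ∷ []) (# 3 , # 4)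
module Family₁ = Pumping pr₁ (# 3) (# 0) (# 1 ∷ # 3 ∷ # 2 ∷ # 0 ∷ # 3 ∷ # 5 ∷ # 0 ∷ # 4 ∷ []) (# 5 ∷ # 0 ∷ # 4 ∷ []) (# 0 , # 4)
module Family₂ = Pumping pr₁ (# 3) (# 0) (# 0 ∷ # 3 ∷ # 3 ∷ # 0 ∷ # 1 ∷ # 3 ∷ # 2 ∷ # 0 ∷ # 3 ∷ # 5 ∷ # 0 ∷ # 4 ∷ [])
                                         (# 5 ∷ # 0 ∷ # 4 ∷ []) (# 0 , # 4)

prc-9+3j : ∀ j → HasPrcPartition (CycleAdj (9 + j * 3)) 6
prc-9+3j = Family₀.pumped-prc (from-yes Family₀.pumpable?)

prc-10+3j : ∀ j → HasPrcPartition (CycleAdj (10 + j * 3)) 6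
prc-10+3j = Family₁.pumped-prc (from-yes Family₁.pumpable?)

prc-14+3j : ∀ j → HasPrcPartition (CycleAdj (14 + j * 3)) 6
prc-14+3j = Family₂.pumped-prc (from-yes Family₂.pumpable?)

residue : ∀ d → d ≢ 2 → ∃ λ j → d ≡ j * 3 ⊎ d ≡ 1 + j * 3 ⊎ d ≡ 5 + j * 3
residue 0 _ = 0 , inj₁ refl
residue 1 _ = 0 , inj₂ (inj₁ refl)
residue 2 2≢2 = ⊥-elim (2≢2 refl)
residue (ℕ.suc (ℕ.suc (ℕ.suc d))) _ with d ℕ.≟ 2
... | yes refl = 0 , inj₂ (inj₂ refl)
... | no d≢2 with residue d d≢2
...   | j , inj₁ e        = ℕ.suc j , inj₁ (cong (3 +_) e)
...   | j , inj₂ (inj₁ e) = ℕ.suc j , inj₂ (inj₁ (cong (3 +_) e))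
...   | j , inj₂ (inj₂ e) = ℕ.suc j , inj₂ (inj₂ (cong (3 +_) e))

prc-six : ∀ n → 9 ≤ n → n ≢ 11 → HasPrcPartition (CycleAdj n) 6
prc-six n 9≤n n≢11 with m≤n⇒∃[o]m+o≡n 9≤n
... | d , refl with residue d (n≢11 ∘ cong (9 +_))
...   | j , inj₁ refl        = prc-9+3j j
...   | j , inj₂ (inj₁ refl) = prc-10+3j j
...   | j , inj₂ (inj₂ refl) = prc-14+3j j

lemma3p6 : (n : ℕ) → 9 ≤ n → ¬ (n ≡ 11) → PRC≡ (CycleAdj n) 6
lemma3p6 n 9≤n n≢11 = inj₂ (prc-six n 9≤n n≢11 , λ k → prc-size≤6 (≤-trans (m≤m+n 4 5) 9≤n))
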